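{- Let $G$ be a finite simple undirected graph with $m$ edges and arboricity $\alpha(G)$. Let $e_1, \ldots, e_m$ be an ordering of $E(G)$, and write $e_i = v_i w_i$ (one endpoint of $e_i$ being designated $v_i$ and the other $w_i$). For $1 \le i \le m$ let $G_i$ be the graph with vertex set $V(G)$ and edge set $\{e_1,\ldots,e_i\}$, and let $h_i(v)$ denote the number of neighbours $u$ of $v$ in $G_i$ with $d_{G_i}(u) \ge d_{G_i}(v)$. Then \[\sum_{i=1}^{m} h_i(v_i) \le 4\alpha(G)\, m.\]
   Context: All graphs are finite, simple and undirected. $d_G(v)$ denotes the degree of $v$ in $G$. The arboricity $\alpha(G)$ is the minimum number of edge-disjoint spanning forests into which $E(G)$ can be decomposed. For a vertex $v$ of a graph, $h(v)$ denotes the number of neighbours of $v$ whose degree is at least $d(v)$. -}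

module Defs where

open import Data.Nat using (ℕ; zero; suc; _+_; _*_; _≤_; _<_; _<ᵇ_; _≤ᵇ_)
open import Data.Fin using (Fin; zero; suc; toℕ; inject₁; fromℕ; _≟_)
open import Data.Bool using (Bool; true; false; _∧_; _∨_; if_then_else_)
open import Data.Product using (_×_; Σ; ∃; proj₁; proj₂; _,_)
open import Data.Sum using (_⊎_)
open import Relation.Binary.PropositionalEquality using (_≡_)
open import Relation.Nullary using (¬_; Dec)
open import Relation.Nullary.Decidable using (⌊_⌋)
open import Function.Definitions using (Injective)

-- A finite simple graph G on vertex set Fin n with m edges, given together
-- with an ordering of its edges: e j = (v_{j+1} , w_{j+1}) for j : Fin m.
Edge : ℕ → Set
Edge n = Fin n × Fin n

Joins : ∀ {n} → Fin n → Fin n → Edge n → Set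
Joins u x (a , b) = (u ≡ a × x ≡ b) ⊎ (u ≡ b × x ≡ a)

IsSimple : ∀ {n m} → (Fin m → Edge n) → Set
IsSimple {n} {m} e =
  (∀ j → ¬ (proj₁ (e j) ≡ proj₂ (e j))) ×
  (∀ j k → Joins (proj₁ (e j)) (proj₂ (e j)) (e k) → j ≡ k)

count : ∀ {k} → (Fin k → Bool) → ℕ
count {zero}  p = 0
count {suc k} p = (if p zero then 1 else 0) + count (λ i → p (suc i))

any : ∀ {k} → (Fin k → Bool) → Bool
any {zero}  p = false
any {suc k} p = p zero ∨ any (λ i → p (suc i))

sumFin : ∀ {k} → (Fin k → ℕ) → ℕ
sumFin {zero}  f = 0
sumFin {suc k} f = f zero + sumFin (λ i → f (suc i))

incidentᵇ : ∀ {n} → Fin n → Edge n → Bool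
incidentᵇ u (a , b) = ⌊ u ≟ a ⌋ ∨ ⌊ u ≟ b ⌋

joinsᵇ : ∀ {n} → Fin n → Fin n → Edge n → Bool
joinsᵇ u x (a , b) = (⌊ u ≟ a ⌋ ∧ ⌊ x ≟ b ⌋) ∨ (⌊ u ≟ b ⌋ ∧ ⌊ x ≟ a ⌋)

-- G_i : vertex set Fin n, edges e_1 … e_i, i.e. indices j with toℕ j < i
inGi : ∀ {m} → ℕ → Fin m → Bool
inGi i j = toℕ j <ᵇ i

deg : ∀ {n m} → (Fin m → Edge n) → ℕ → Fin n → ℕ
deg e i u = count (λ j → inGi i j ∧ incidentᵇ u (e j))

adjᵇ : ∀ {n m} → (Fin m → Edge n) → ℕ → Fin n → Fin n → Bool
adjᵇ e i u x = any (λ j → inGi i j ∧ joinsᵇ u x (e j))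

h : ∀ {n m} → (Fin m → Edge n) → ℕ → Fin n → ℕ
h e i v = count (λ u → adjᵇ e i v u ∧ (deg e i v ≤ᵇ deg e i u))

-- Σ_{i=1}^{m} h_i(v_i)   (index j : Fin m corresponds to i = j+1)
hSum : ∀ {n m} → (Fin m → Edge n) → ℕ
hSum e = sumFin (λ j → h e (suc (toℕ j)) (proj₁ (e j)))

AdjIn : ∀ {n m} → (Fin m → Edge n) → (Fin m → Set) → Fin n → Fin n → Set
AdjIn e S u x = ∃ λ j → S j × Joins u x (e j)

HasCycle : ∀ {n m} → (Fin m → Edge n) → (Fin m → Set) → Set
HasCycle {n} e S =
  Σ ℕ λ k → Σ (Fin (suc (suc (suc k))) → Fin n) λ f →
    Injective _≡_ _≡_ f ×
    (∀ (i : Fin (suc (suc k))) → AdjIn e S (f (inject₁ i)) (f (suc i))) ×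
    AdjIn e S (f (fromℕ (suc (suc k)))) (f zero)

IsForest : ∀ {n m} → (Fin m → Edge n) → (Fin m → Set) → Set
IsForest e S = ¬ HasCycle e S

DecomposesInto : ∀ {n m} → (Fin m → Edge n) → ℕ → Set
DecomposesInto {n} {m} e k =
  Σ (Fin m → Fin k) λ col → ∀ (c : Fin k) → IsForest e (λ j → col j ≡ c)

IsArboricity : ∀ {n m} → (Fin m → Edge n) → ℕ → Set
IsArboricity e α = DecomposesInto e α × (∀ k → k < α → ¬ DecomposesInto e k)

module Submission where

-- A neighbour u of v_i with d(u) ≥ d(v_i) in G_i is charged to the edge
-- joining them (h≤lowEnds).  Summing over i, the edge ab receives the
-- number of times i at which v_i = a and d_{G_{i+1}}(a) ≤ d_{G_{i+1}}(b)
-- (plus the same with a and b swapped).  Each such time raises d(a), and at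
-- these times d(a) has not overtaken d(b), so this happens at most
-- min(d(a), d(b)) times (record-bound).  Hence Σ_i h_i(v_i) ≤ 2 Σ_j w(e_j)
-- with the edge weight w(ab) = min(d_G(a), d_G(b)) (hSum≤minDegs).
-- In a forest every edge can be assigned one of its endpoints injectively
-- (remove a leaf edge and assign it its leaf; leaves exist since a walk
-- that never backtracks closes a cycle), so the weights of a forest sum to
-- at most Σ_v d(v) ≤ 2m (forest-weight).  Splitting E(G) into α forests
-- gives Σ_j w(e_j) ≤ 2αm, and the theorem follows.

open import Defs
open import Data.Nat using (ℕ; zero; suc; _+_; _*_; _≤_; _<_; _⊓_; _≤ᵇ_; z≤n; s≤s)
import Data.Nat.Properties as ℕₚ
open import Data.Nat.Properties
  using (≤-refl; ≤-trans; ≤-reflexive; +-comm; +-assoc; +-identityʳ; *-zeroʳ; *-identityʳ;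
         +-mono-≤; +-monoˡ-≤; +-monoʳ-≤; *-monoʳ-≤; m≤m+n; m≤n+m; ⊓-glb; ⊓-comm; m⊓n≤m; m⊓n≤n;
         ≤ᵇ⇒≤; 0≢1+n; <⇒≢; n<1+n; m<1+n⇒m<n∨m≡n; m≤n⇒∃[o]m+o≡n; +-cancelʳ-≡; +-monoˡ-<;
         +-*-semiring; module ≤-Reasoning)
open import Data.Fin using (Fin; zero; suc; toℕ; _≟_; inject₁; fromℕ; fromℕ<)
open import Data.Fin.Properties
  using (suc-injective; toℕ-injective; toℕ<n; toℕ-inject₁; toℕ-fromℕ; toℕ-fromℕ<; pigeonhole; any?)
open import Data.Bool using (Bool; true; false; _∧_; _∨_; not; if_then_else_; T)
open import Data.Product using (_×_; Σ; ∃; proj₁; proj₂; _,_)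
open import Data.Sum using (_⊎_; inj₁; inj₂)
open import Data.Unit using (tt)
open import Data.Empty using (⊥-elim)
open import Function using (_∘_; Equivalence)
open import Data.Bool.Properties using (∧-identityʳ; T-∧)
open import Relation.Binary.PropositionalEquality
  using (_≡_; _≢_; refl; sym; trans; cong; cong₂; subst; subst₂; module ≡-Reasoning)
open import Relation.Nullary using (¬_; Dec; yes; no)
open import Relation.Nullary.Decidable using (⌊_⌋; toWitness; T?; ¬?; _×-dec_; _⊎-dec_)
open import Data.Nat.Tactic.RingSolver using (solve-∀)
open import Algebra.Properties.Semiring.Sum +-*-semiring
  using (sum; sum-cong-≗; sum-replicate-zero; ∑-distrib-+; ∑-comm; *-distribˡ-sum)

⟨_⟩ : Bool → ℕ
⟨ b ⟩ = if b then 1 else 0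

sumFin≡sum : ∀ {k} (f : Fin k → ℕ) → sumFin f ≡ sum f
sumFin≡sum {zero}  f = refl
sumFin≡sum {suc k} f = cong (f zero +_) (sumFin≡sum (λ i → f (suc i)))

sum-cong : ∀ {k} {f g : Fin k → ℕ} → (∀ i → f i ≡ g i) → sumFin f ≡ sumFin g
sum-cong {zero}  eq = refl
sum-cong {suc k} eq = cong₂ _+_ (eq zero) (sum-cong (λ i → eq (suc i)))

sum-mono : ∀ {k} {f g : Fin k → ℕ} → (∀ i → f i ≤ g i) → sumFin f ≤ sumFin g
sum-mono {zero}  le = z≤n
sum-mono {suc k} le = +-mono-≤ (le zero) (sum-mono (λ i → le (suc i)))

sum-zero : ∀ k → sumFin {k} (λ _ → 0) ≡ 0
sum-zero k = trans (sumFin≡sum {k} (λ _ → 0)) (sum-replicate-zero k)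

sum-const : ∀ k c → sumFin {k} (λ _ → c) ≡ k * c
sum-const zero    c = refl
sum-const (suc k) c = cong (c +_) (sum-const k c)

sum-distrib : ∀ {k} (f g : Fin k → ℕ) → sumFin (λ i → f i + g i) ≡ sumFin f + sumFin g
sum-distrib f g = begin
  sumFin (λ i → f i + g i) ≡⟨ sumFin≡sum (λ i → f i + g i) ⟩
  sum (λ i → f i + g i)    ≡⟨ ∑-distrib-+ f g ⟩
  sum f + sum g            ≡⟨ sym (cong₂ _+_ (sumFin≡sum f) (sumFin≡sum g)) ⟩
  sumFin f + sumFin g      ∎
  where open ≡-Reasoning

sum-comm : ∀ {k l} (f : Fin k → Fin l → ℕ) →
  sumFin (λ i → sumFin (f i)) ≡ sumFin (λ j → sumFin (λ i → f i j))
sum-comm f = begin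
  sumFin (λ i → sumFin (f i))          ≡⟨ sumFin≡sum (λ i → sumFin (f i)) ⟩
  sum (λ i → sumFin (f i))             ≡⟨ sum-cong-≗ (λ i → sumFin≡sum (f i)) ⟩
  sum (λ i → sum (f i))                ≡⟨ ∑-comm f ⟩
  sum (λ j → sum (λ i → f i j))        ≡⟨ sum-cong-≗ (λ j → sym (sumFin≡sum (λ i → f i j))) ⟩
  sum (λ j → sumFin (λ i → f i j))     ≡⟨ sym (sumFin≡sum (λ j → sumFin (λ i → f i j))) ⟩
  sumFin (λ j → sumFin (λ i → f i j))  ∎
  where open ≡-Reasoning

sum-*ˡ : ∀ {k} c (f : Fin k → ℕ) → sumFin (λ i → c * f i) ≡ c * sumFin f
sum-*ˡ c f = begin
  sumFin (λ i → c * f i) ≡⟨ sumFin≡sum (λ i → c * f i) ⟩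
  sum (λ i → c * f i)    ≡⟨ sym (*-distribˡ-sum c f) ⟩
  c * sum f              ≡⟨ cong (c *_) (sym (sumFin≡sum f)) ⟩
  c * sumFin f           ∎
  where open ≡-Reasoning

sum-point : ∀ {k} (b : Fin k) (g : Fin k → ℕ) →
  sumFin (λ u → if ⌊ u ≟ b ⌋ then g u else 0) ≡ g b
sum-point {suc k} zero    g = trans (cong (g zero +_) (sum-zero k)) (+-identityʳ (g zero))
sum-point {suc k} (suc b) g = trans (sum-cong shift) (sum-point b (λ u → g (suc u)))
  where
  shift : ∀ u → (if ⌊ suc u ≟ suc b ⌋ then g (suc u) else 0)
              ≡ (if ⌊ u ≟ b ⌋ then g (suc u) else 0)
  shift u with u ≟ b
  ... | yes _ = refl
  ... | no  _ = refl

count≡sum : ∀ {k} (p : Fin k → Bool) → count p ≡ sumFin (λ i → ⟨ p i ⟩)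
count≡sum {zero}  p = refl
count≡sum {suc k} p = cong (⟨ p zero ⟩ +_) (count≡sum (λ i → p (suc i)))

any∧≤sum : ∀ {k} (q : Fin k → Bool) c → ⟨ any q ∧ c ⟩ ≤ sumFin (λ j → ⟨ q j ∧ c ⟩)
any∧≤sum {zero}  q c = z≤n
any∧≤sum {suc k} q c =
  ≤-trans (∨-bound (q zero) _ c) (+-monoʳ-≤ ⟨ q zero ∧ c ⟩ (any∧≤sum (λ i → q (suc i)) c))
  where
  ∨-bound : ∀ x y c → ⟨ (x ∨ y) ∧ c ⟩ ≤ ⟨ x ∧ c ⟩ + ⟨ y ∧ c ⟩
  ∨-bound false y c     = ≤-refl
  ∨-bound true  y false = z≤n
  ∨-bound true  y true  = s≤s z≤n

prefix : ∀ {m} → ℕ → (Fin m → Bool) → ℕ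
prefix t Q = sumFin (λ i → ⟨ inGi t i ∧ Q i ⟩)

prefix-zero : ∀ {m} (Q : Fin m → Bool) → prefix 0 Q ≡ 0
prefix-zero {m} Q = sum-zero m

prefix-all : ∀ {m} (Q : Fin m → Bool) → prefix m Q ≡ sumFin (λ i → ⟨ Q i ⟩)
prefix-all {zero}  Q = refl
prefix-all {suc m} Q = cong (⟨ Q zero ⟩ +_) (prefix-all (λ i → Q (suc i)))

prefix-step : ∀ {m} t →
  (∀ Q → prefix {m} (suc t) Q ≡ prefix t Q) ⊎
  (∃ λ (i : Fin m) → toℕ i ≡ t × ∀ Q → prefix (suc t) Q ≡ prefix t Q + ⟨ Q i ⟩)
prefix-step {zero}  t    = inj₁ (λ Q → refl)
prefix-step {suc m} zero = inj₂ (zero , refl , λ Q → +-comm ⟨ Q zero ⟩ (sumFin {m} (λ _ → 0)))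
prefix-step {suc m} (suc t) with prefix-step {m} t
... | inj₁ same = inj₁ (λ Q → cong (⟨ Q zero ⟩ +_) (same (λ i → Q (suc i))))
... | inj₂ (i , i≡t , grow) = inj₂ (suc i , cong suc i≡t , λ Q →
        trans (cong (⟨ Q zero ⟩ +_) (grow (λ i → Q (suc i)))) (sym (+-assoc ⟨ Q zero ⟩ _ _)))

deg≡prefix : ∀ {n m} (e : Fin m → Edge n) t x → deg e t x ≡ prefix t (λ j → incidentᵇ x (e j))
deg≡prefix e t x = count≡sum (λ j → inGi t j ∧ incidentᵇ x (e j))

record-step : ∀ L A B r a b → L ≤ A → L ≤ B →
  (T r → T a × A + ⟨ a ⟩ ≤ B + ⟨ b ⟩) →
  L + ⟨ r ⟩ ≤ A + ⟨ a ⟩ × L + ⟨ r ⟩ ≤ B + ⟨ b ⟩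
record-step L A B false a b L≤A L≤B _ =
  ≤-trans (≤-reflexive (+-identityʳ L)) (≤-trans L≤A (m≤m+n A _)) ,
  ≤-trans (≤-reflexive (+-identityʳ L)) (≤-trans L≤B (m≤m+n B _))
record-step L A B true true  b L≤A L≤B grows = +-monoˡ-≤ 1 L≤A , ≤-trans (+-monoˡ-≤ 1 L≤A) (proj₂ (grows tt))
record-step L A B true false b L≤A L≤B grows with proj₁ (grows tt)
... | ()

record-bound : ∀ {m} (R A B : Fin m → Bool) →
  (∀ i → T (R i) → T (A i) × prefix (suc (toℕ i)) A ≤ prefix (suc (toℕ i)) B) →
  ∀ t → prefix t R ≤ prefix t A × prefix t R ≤ prefix t B
record-bound R A B hyp zero = empty≤ , empty≤
  where
  empty≤ : ∀ {x} → prefix 0 R ≤ x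
  empty≤ = subst (_≤ _) (sym (prefix-zero R)) z≤n
record-bound R A B hyp (suc t) with record-bound R A B hyp t | prefix-step t
... | R≤A , R≤B | inj₁ same rewrite same R | same A | same B = R≤A , R≤B
... | R≤A , R≤B | inj₂ (i , refl , grow) rewrite grow R | grow A | grow B =
  record-step _ _ _ (R i) (A i) (B i) R≤A R≤B
    (λ r → proj₁ (hyp i r) , subst₂ _≤_ (grow A) (grow B) (proj₂ (hyp i r)))

lowEnd : ∀ {n} → (Fin n → ℕ) → Fin n → Fin n → Fin n → Bool
lowEnd d v a b = ⌊ v ≟ a ⌋ ∧ (d a ≤ᵇ d b)

charge : ∀ {n} (g : Bool) (v u a b : Fin n) (d : Fin n → ℕ) →
  ⟨ (g ∧ joinsᵇ v u (a , b)) ∧ (d v ≤ᵇ d u) ⟩ ≤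
    (if ⌊ u ≟ b ⌋ then ⟨ lowEnd d v a b ⟩ else 0) +
    (if ⌊ u ≟ a ⌋ then ⟨ lowEnd d v b a ⟩ else 0)
charge false v u a b d = z≤n
charge true  v u a b d with v ≟ a | u ≟ b | v ≟ b | u ≟ a
... | yes refl | yes refl | _        | _        = m≤m+n _ _
... | no _     | _        | yes refl | yes refl = m≤n+m _ _
... | yes _    | no _     | yes refl | yes refl = m≤n+m _ _
... | no _     | _        | no _     | _        = z≤n
... | no _     | _        | yes _    | no _     = z≤n
... | yes _    | no _     | no _     | _        = z≤n
... | yes _    | no _     | yes _    | no _     = z≤n

incident-first : ∀ {n} (x y : Fin n) → T (incidentᵇ x (x , y))
incident-first x y with x ≟ x
... | yes _   = tt
... | no x≢x = ⊥-elim (x≢x refl)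

module Charging {n m : ℕ} (e : Fin m → Edge n) where

  vOf wOf : Fin m → Fin n
  vOf j = proj₁ (e j)
  wOf j = proj₂ (e j)

  h≤lowEnds : ∀ t v → h e t v ≤
    sumFin (λ j → ⟨ lowEnd (deg e t) v (vOf j) (wOf j) ⟩ + ⟨ lowEnd (deg e t) v (wOf j) (vOf j) ⟩)
  h≤lowEnds t v = begin
    h e t v
      ≡⟨ count≡sum (λ u → adjᵇ e t v u ∧ heavy u) ⟩
    sumFin (λ u → ⟨ adjᵇ e t v u ∧ heavy u ⟩)
      ≤⟨ sum-mono (λ u → any∧≤sum (λ j → inGi t j ∧ joinsᵇ v u (e j)) (heavy u)) ⟩
    sumFin (λ u → sumFin (λ j → ⟨ (inGi t j ∧ joinsᵇ v u (e j)) ∧ heavy u ⟩))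
      ≡⟨ sum-comm (λ u j → ⟨ (inGi t j ∧ joinsᵇ v u (e j)) ∧ heavy u ⟩) ⟩
    sumFin (λ j → sumFin (λ u → ⟨ (inGi t j ∧ joinsᵇ v u (e j)) ∧ heavy u ⟩))
      ≤⟨ sum-mono (λ j → sum-mono (λ u → charge (inGi t j) v u (vOf j) (wOf j) (deg e t))) ⟩
    sumFin (λ j → sumFin (λ u → (if ⌊ u ≟ wOf j ⌋ then X j else 0) + (if ⌊ u ≟ vOf j ⌋ then Y j else 0)))
      ≡⟨ sum-cong (λ j → trans (sum-distrib (λ u → if ⌊ u ≟ wOf j ⌋ then X j else 0)
                                             (λ u → if ⌊ u ≟ vOf j ⌋ then Y j else 0))
                               (cong₂ _+_ (sum-point (wOf j) (λ _ → X j)) (sum-point (vOf j) (λ _ → Y j)))) ⟩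
    sumFin (λ j → X j + Y j) ∎
    where
    open ≤-Reasoning
    heavy : Fin n → Bool
    heavy u = deg e t v ≤ᵇ deg e t u
    X Y : Fin m → ℕ
    X j = ⟨ lowEnd (deg e t) v (vOf j) (wOf j) ⟩
    Y j = ⟨ lowEnd (deg e t) v (wOf j) (vOf j) ⟩

  lowCount : Fin n → Fin n → ℕ
  lowCount a b = sumFin (λ i → ⟨ lowEnd (deg e (suc (toℕ i))) (vOf i) a b ⟩)

  -- Every such moment raises the degree of a, and the degree of a never
  -- exceeds that of b at these moments; so they happen at most
  -- min(d(a), d(b)) times.
  lowCount≤minDeg : ∀ a b → lowCount a b ≤ deg e m a ⊓ deg e m b
  lowCount≤minDeg a b =
    subst₂ _≤_ (prefix-all R) (cong₂ _⊓_ (sym (deg≡prefix e m a)) (sym (deg≡prefix e m b)))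
      (⊓-glb (proj₁ (bound m)) (proj₂ (bound m)))
    where
    R A B : Fin m → Bool
    R i = lowEnd (deg e (suc (toℕ i))) (vOf i) a b
    A j = incidentᵇ a (e j)
    B j = incidentᵇ b (e j)
    moment : ∀ i → T (R i) → T (A i) × prefix (suc (toℕ i)) A ≤ prefix (suc (toℕ i)) B
    moment i r with vOf i ≟ a
    ... | yes v≡a = subst (λ x → T (incidentᵇ x (e i))) v≡a (incident-first (vOf i) (wOf i)) ,
                    subst₂ _≤_ (deg≡prefix e (suc (toℕ i)) a) (deg≡prefix e (suc (toℕ i)) b) (≤ᵇ⇒≤ _ _ r)
    ... | no _     = ⊥-elim r
    bound : ∀ t → prefix t R ≤ prefix t A × prefix t R ≤ prefix t B
    bound = record-bound R A B moment

  minDeg : Fin m → ℕ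
  minDeg j = deg e m (vOf j) ⊓ deg e m (wOf j)

  hSum≤minDegs : hSum e ≤ sumFin minDeg + sumFin minDeg
  hSum≤minDegs = begin
    hSum e
      ≤⟨ sum-mono (λ i → h≤lowEnds (suc (toℕ i)) (vOf i)) ⟩
    sumFin (λ i → sumFin (λ j → low i (vOf j) (wOf j) + low i (wOf j) (vOf j)))
      ≡⟨ sum-comm (λ i j → low i (vOf j) (wOf j) + low i (wOf j) (vOf j)) ⟩
    sumFin (λ j → sumFin (λ i → low i (vOf j) (wOf j) + low i (wOf j) (vOf j)))
      ≡⟨ sum-cong (λ j → sum-distrib (λ i → low i (vOf j) (wOf j)) (λ i → low i (wOf j) (vOf j))) ⟩
    sumFin (λ j → lowCount (vOf j) (wOf j) + lowCount (wOf j) (vOf j))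
      ≤⟨ sum-mono (λ j → +-mono-≤ (lowCount≤minDeg (vOf j) (wOf j))
                                  (≤-trans (lowCount≤minDeg (wOf j) (vOf j)) (≤-reflexive (⊓-comm _ _)))) ⟩
    sumFin (λ j → minDeg j + minDeg j)
      ≡⟨ sum-distrib minDeg minDeg ⟩
    sumFin minDeg + sumFin minDeg ∎
    where
    open ≤-Reasoning
    low : Fin m → Fin n → Fin n → ℕ
    low i a b = ⟨ lowEnd (deg e (suc (toℕ i))) (vOf i) a b ⟩

handshake : ∀ {n m} (e : Fin m → Edge n) t → sumFin (deg e t) ≤ m * 2
handshake {m = m} e t = begin
  sumFin (deg e t)
    ≡⟨ sum-cong (deg≡prefix e t) ⟩
  sumFin (λ v → sumFin (λ j → ⟨ inGi t j ∧ incidentᵇ v (e j) ⟩))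
    ≡⟨ sum-comm (λ v j → ⟨ inGi t j ∧ incidentᵇ v (e j) ⟩) ⟩
  sumFin (λ j → sumFin (λ v → ⟨ inGi t j ∧ incidentᵇ v (e j) ⟩))
    ≤⟨ sum-mono (λ j → sum-mono (λ v → ends (inGi t j) ⌊ v ≟ proj₁ (e j) ⌋ ⌊ v ≟ proj₂ (e j) ⌋)) ⟩
  sumFin (λ j → sumFin (λ v → ⟨ ⌊ v ≟ proj₁ (e j) ⌋ ⟩ + ⟨ ⌊ v ≟ proj₂ (e j) ⌋ ⟩))
    ≡⟨ sum-cong (λ j → trans (sum-distrib (λ v → ⟨ ⌊ v ≟ proj₁ (e j) ⌋ ⟩) (λ v → ⟨ ⌊ v ≟ proj₂ (e j) ⌋ ⟩))
                             (cong₂ _+_ (sum-point (proj₁ (e j)) (λ _ → 1)) (sum-point (proj₂ (e j)) (λ _ → 1)))) ⟩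
  sumFin {m} (λ _ → 2)
    ≡⟨ sum-const m 2 ⟩
  m * 2 ∎
  where
  open ≤-Reasoning
  ends : ∀ g x y → ⟨ g ∧ (x ∨ y) ⟩ ≤ ⟨ x ⟩ + ⟨ y ⟩
  ends false x     y = z≤n
  ends true  false y = ≤-refl
  ends true  true  y = s≤s z≤n

sum-unique≤1 : ∀ {k} (p : Fin k → Bool) → (∀ i j → T (p i) → T (p j) → i ≡ j) →
  sumFin (λ i → ⟨ p i ⟩) ≤ 1
sum-unique≤1 {zero}  p once = z≤n
sum-unique≤1 {suc k} p once with p zero in p0
... | true  = ≤-reflexive (cong suc (trans (sum-cong none) (sum-zero k)))
  where
  none : ∀ i → ⟨ p (suc i) ⟩ ≡ 0
  none i with p (suc i) in pi
  ... | false = refl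
  ... | true with once zero (suc i) (subst T (sym p0) tt) (subst T (sym pi) tt)
  ...   | ()
... | false = sum-unique≤1 (λ i → p (suc i)) (λ i j pi pj → suc-injective (once (suc i) (suc j) pi pj))

injective-sum : ∀ {n m} (S : Fin m → Bool) (τ : Fin m → Fin n) →
  (∀ i j → T (S i) → T (S j) → τ i ≡ τ j → i ≡ j) → (g : Fin n → ℕ) →
  sumFin (λ j → if S j then g (τ j) else 0) ≤ sumFin g
injective-sum {n} {m} S τ injective g = begin
  sumFin (λ j → if S j then g (τ j) else 0)
    ≡⟨ sum-cong spread ⟩
  sumFin (λ j → sumFin (λ v → if hits j v then g v else 0))
    ≡⟨ sum-comm (λ j v → if hits j v then g v else 0) ⟩
  sumFin (λ v → sumFin (λ j → if hits j v then g v else 0))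
    ≡⟨ sum-cong (λ v → trans (sum-cong (λ j → if≡* (hits j v) (g v))) (sum-*ˡ (g v) (λ j → ⟨ hits j v ⟩))) ⟩
  sumFin (λ v → g v * sumFin (λ j → ⟨ hits j v ⟩))
    ≤⟨ sum-mono (λ v → ≤-trans (*-monoʳ-≤ (g v) (sum-unique≤1 (λ j → hits j v) (once v)))
                               (≤-reflexive (*-identityʳ (g v)))) ⟩
  sumFin g ∎
  where
  open ≤-Reasoning
  hits : Fin m → Fin n → Bool
  hits j v = S j ∧ ⌊ v ≟ τ j ⌋
  spread : ∀ j → (if S j then g (τ j) else 0) ≡ sumFin (λ v → if hits j v then g v else 0)
  spread j with S j
  ... | true  = sym (sum-point (τ j) g)
  ... | false = sym (sum-zero n)
  if≡* : ∀ b x → (if b then x else 0) ≡ x * ⟨ b ⟩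
  if≡* false x = sym (*-zeroʳ x)
  if≡* true  x = sym (*-identityʳ x)
  once : ∀ v i j → T (hits i v) → T (hits j v) → i ≡ j
  once v i j hi hj with S i in si | S j in sj
  ... | true | true = injective i j (subst T (sym si) tt) (subst T (sym sj) tt)
                        (trans (sym (toWitness hi)) (toWitness hj))

InjectiveBelow : ∀ {n} → (ℕ → Fin n) → ℕ → Set
InjectiveBelow Y q = ∀ {a b} → a < q → b < q → Y a ≡ Y b → a ≡ b

record FirstReturn {n} (Y : ℕ → Fin n) : Set where
  field
    start end : ℕ
    start<end : start < end
    returns   : Y start ≡ Y end
    distinct  : InjectiveBelow Y end

scan : ∀ {n} (Y : ℕ → Fin n) q → InjectiveBelow Y q ⊎ FirstReturn Y
scan Y zero = inj₁ (λ ())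
scan Y (suc q) with scan Y q
... | inj₂ found = inj₂ found
... | inj₁ distinct with any? (λ (i : Fin q) → Y (toℕ i) ≟ Y q)
...   | yes (i , Yi≡Yq) = inj₂ (record { start = toℕ i ; end = q ; start<end = toℕ<n i
                                        ; returns = Yi≡Yq ; distinct = distinct })
...   | no fresh = inj₁ extend
  where
  earlier : ∀ {a} → a < q → Y a ≢ Y q
  earlier a<q Ya≡Yq = fresh (fromℕ< a<q , trans (cong Y (toℕ-fromℕ< a<q)) Ya≡Yq)
  extend : InjectiveBelow Y (suc q)
  extend a<1+q b<1+q Ya≡Yb with m<1+n⇒m<n∨m≡n a<1+q | m<1+n⇒m<n∨m≡n b<1+q
  ... | inj₁ a<q  | inj₁ b<q  = distinct a<q b<q Ya≡Yb
  ... | inj₂ refl | inj₂ refl = refl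
  ... | inj₁ a<q  | inj₂ refl = ⊥-elim (earlier a<q Ya≡Yb)
  ... | inj₂ refl | inj₁ b<q  = ⊥-elim (earlier b<q (sym Ya≡Yb))

firstReturn : ∀ {n} (Y : ℕ → Fin n) → FirstReturn Y
firstReturn {n} Y with scan Y (suc n)
... | inj₂ found = found
... | inj₁ distinct with pigeonhole (n<1+n n) (λ (i : Fin (suc n)) → Y (toℕ i))
...   | i , j , i<j , Yi≡Yj = ⊥-elim (<⇒≢ i<j (distinct (toℕ<n i) (toℕ<n j) Yi≡Yj))

joins-sym : ∀ {n} {u x : Fin n} {E} → Joins u x E → Joins x u E
joins-sym (inj₁ (p , q)) = inj₂ (q , p)
joins-sym (inj₂ (p , q)) = inj₁ (q , p)

joins-same : ∀ {n} {u x a b : Fin n} {E} → Joins u x (a , b) → Joins u x E → Joins a b E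
joins-same (inj₁ (refl , refl)) q = q
joins-same (inj₂ (refl , refl)) q = joins-sym q

joins-loop : ∀ {n} {y a b : Fin n} → Joins y y (a , b) → a ≡ b
joins-loop (inj₁ (p , q)) = trans (sym p) q
joins-loop (inj₂ (p , q)) = trans (sym q) p

record Walk {n m} (e : Fin m → Edge n) (S : Fin m → Set) : Set where
  field
    vertex      : ℕ → Fin n
    edge        : ℕ → Fin m
    inS         : ∀ t → S (edge t)
    along       : ∀ t → Joins (vertex t) (vertex (suc t)) (e (edge (suc t)))
    noBacktrack : ∀ t → edge (suc t) ≢ edge t

module _ {n m : ℕ} {e : Fin m → Edge n} {S : Fin m → Set} (simple : IsSimple e) where

  later : Walk e S → ℕ → Walk e S
  later W p = record
    { vertex = λ t → vertex (t + p) ; edge = λ t → edge (t + p) ; inS = λ t → inS (t + p)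
    ; along = λ t → along (t + p) ; noBacktrack = λ t → noBacktrack (t + p) }
    where open Walk W

  -- A walk returning to its start at time d+1, without earlier repetition,
  -- goes around a cycle: returns after one or two steps are excluded by
  -- simplicity and the absence of backtracking.
  return⇒cycle : (W : Walk e S) (d : ℕ) → let open Walk W in
    vertex 0 ≡ vertex (suc d) → InjectiveBelow vertex (suc d) → HasCycle e S
  return⇒cycle W zero back distinct =
    ⊥-elim (proj₁ simple (edge 1) (joins-loop (subst (λ z → Joins (vertex 0) z (e (edge 1))) (sym back) (along 0))))
    where open Walk W
  return⇒cycle W (suc zero) back distinct =
    ⊥-elim (noBacktrack 1 (sym (proj₂ simple (edge 1) (edge 2) (joins-same (along 0) parallel))))
    where
    open Walk W
    parallel : Joins (vertex 0) (vertex 1) (e (edge 2))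
    parallel = joins-sym (subst (λ z → Joins (vertex 1) z (e (edge 2))) (sym back) (along 1))
  return⇒cycle W (suc (suc k)) back distinct =
    k , (λ i → vertex (toℕ i)) , injective , step , close
    where
    open Walk W
    injective : ∀ {i j} → vertex (toℕ i) ≡ vertex (toℕ j) → i ≡ j
    injective {i} {j} eq = toℕ-injective (distinct (toℕ<n i) (toℕ<n j) eq)
    step : ∀ (i : Fin (suc (suc k))) → AdjIn e S (vertex (toℕ (inject₁ i))) (vertex (suc (toℕ i)))
    step i = edge (suc (toℕ i)) , inS _ ,
      subst (λ z → Joins (vertex z) (vertex (suc (toℕ i))) (e (edge (suc (toℕ i))))) (sym (toℕ-inject₁ i))
        (along (toℕ i))
    close : AdjIn e S (vertex (toℕ (fromℕ (suc (suc k))))) (vertex 0)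
    close = edge (suc (suc (suc k))) , inS _ ,
      subst₂ (λ y z → Joins (vertex y) z (e (edge (suc (suc (suc k))))))
        (sym (toℕ-fromℕ (suc (suc k)))) (sym back) (along (suc (suc k)))

  walk⇒cycle : Walk e S → HasCycle e S
  walk⇒cycle W = return⇒cycle (later W start) d back distinct′
    where
    open Walk W
    open FirstReturn (firstReturn vertex)
    d = proj₁ (m≤n⇒∃[o]m+o≡n start<end)
    end≡ : end ≡ suc (d + start)
    end≡ = trans (sym (proj₂ (m≤n⇒∃[o]m+o≡n start<end))) (cong suc (+-comm start d))
    back : vertex start ≡ vertex (suc (d + start))
    back = trans returns (cong vertex end≡)
    distinct′ : InjectiveBelow (λ t → vertex (t + start)) (suc d)
    distinct′ {a} {b} a<1+d b<1+d eq = +-cancelʳ-≡ start a b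
      (distinct (subst (a + start <_) (sym end≡) (+-monoˡ-< start a<1+d))
                (subst (b + start <_) (sym end≡) (+-monoˡ-< start b<1+d)) eq)

Endpoint : ∀ {n} → Fin n → Edge n → Set
Endpoint x (a , b) = x ≡ a ⊎ x ≡ b

endpoint? : ∀ {n} (x : Fin n) E → Dec (Endpoint x E)
endpoint? x (a , b) = (x ≟ a) ⊎-dec (x ≟ b)

opposite : ∀ {n} {y : Fin n} {E} → Endpoint y E → Σ (Fin n) λ y′ → Joins y y′ E × Endpoint y′ E
opposite {E = a , b} (inj₁ y≡a) = b , inj₁ (y≡a , refl) , inj₂ refl
opposite {E = a , b} (inj₂ y≡b) = a , inj₂ (y≡b , refl) , inj₁ refl

cycle-mono : ∀ {n m} (e : Fin m → Edge n) {S S′ : Fin m → Set} → (∀ j → S j → S′ j) →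
  HasCycle e S → HasCycle e S′
cycle-mono e S⊆S′ (k , f , injective , step , close) =
  k , f , injective ,
  (λ i → let (j , s , joins) = step i in j , S⊆S′ j s , joins) ,
  (let (j , s , joins) = close in j , S⊆S′ j s , joins)

module Leaves {n m : ℕ} (e : Fin m → Edge n) (S : Fin m → Bool) where

  OtherEdgeAt : Fin m → Fin n → Fin m → Set
  OtherEdgeAt j x k = T (S k) × k ≢ j × Endpoint x (e k)

  Leaf : Set
  Leaf = ∃ λ j → T (S j) × ∃ λ x → Endpoint x (e j) × ¬ ∃ (OtherEdgeAt j x)

  otherEdgeAt? : ∀ j x → Dec (∃ (OtherEdgeAt j x))
  otherEdgeAt? j x = any? (λ k → T? (S k) ×-dec ¬? (k ≟ j) ×-dec endpoint? x (e k))

  leaf? : Dec Leaf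
  leaf? = any? (λ j → T? (S j) ×-dec any? (λ x → endpoint? x (e j) ×-dec ¬? (otherEdgeAt? j x)))

  record Position : Set where
    field
      edge   : Fin m
      vertex : Fin n
      inS    : T (S edge)
      at     : Endpoint vertex (e edge)

  -- A nonempty forest has a leaf: otherwise one could walk on forever,
  -- always leaving a vertex by a new edge, and would close a cycle.
  leaf : IsSimple e → IsForest e (λ j → T (S j)) → (∃ λ j → T (S j)) → Leaf
  leaf simple forest (j₀ , j₀∈S) with leaf?
  ... | yes found = found
  ... | no noLeaf = ⊥-elim (forest (walk⇒cycle simple walk))
    where
    continue : (p : Position) → ∃ (OtherEdgeAt (Position.edge p) (Position.vertex p))
    continue p with otherEdgeAt? (Position.edge p) (Position.vertex p)
    ... | yes other = other
    ... | no none   = ⊥-elim (noLeaf (Position.edge p , Position.inS p , Position.vertex p , Position.at p , none))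
    next : Position → Position
    next p = let (k , k∈S , _ , x∈k) = continue p in
      record { edge = k ; vertex = proj₁ (opposite x∈k) ; inS = k∈S ; at = proj₂ (proj₂ (opposite x∈k)) }
    position : ℕ → Position
    position zero    = record { edge = j₀ ; vertex = proj₁ (e j₀) ; inS = j₀∈S ; at = inj₁ refl }
    position (suc t) = next (position t)
    walk : Walk e (λ j → T (S j))
    walk = record
      { vertex      = λ t → Position.vertex (position t)
      ; edge        = λ t → Position.edge (position t)
      ; inS         = λ t → Position.inS (position t)
      ; along       = λ t → proj₁ (proj₂ (opposite (proj₂ (proj₂ (proj₂ (continue (position t)))))))
      ; noBacktrack = λ t → proj₁ (proj₂ (proj₂ (continue (position t))))
      }

record EndpointChoice {n m} (e : Fin m → Edge n) (S : Fin m → Bool) : Set where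
  field
    choice       : Fin m → Fin n
    isEndpoint   : ∀ j → Endpoint (choice j) (e j)
    injectiveOnS : ∀ i j → T (S i) → T (S j) → choice i ≡ choice j → i ≡ j

without : ∀ {m} → (Fin m → Bool) → Fin m → Fin m → Bool
without S j₀ j = S j ∧ not ⌊ j ≟ j₀ ⌋

without-keeps : ∀ {m} (S : Fin m → Bool) {j₀} i → T (S i) → i ≢ j₀ → T (without S j₀ i)
without-keeps S {j₀} i i∈S i≢j₀ with i ≟ j₀
... | yes i≡j₀ = ⊥-elim (i≢j₀ i≡j₀)
... | no _     = subst T (sym (∧-identityʳ (S i))) i∈S

without-⊆ : ∀ {m} (S : Fin m → Bool) j₀ j → T (without S j₀ j) → T (S j)
without-⊆ S j₀ j = proj₁ ∘ Equivalence.to T-∧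

count-without : ∀ {m} (S : Fin m → Bool) j₀ → T (S j₀) → count S ≡ suc (count (without S j₀))
count-without S j₀ j₀∈S = begin
  count S
    ≡⟨ count≡sum S ⟩
  sumFin (λ j → ⟨ S j ⟩)
    ≡⟨ sum-cong (λ j → split (S j) ⌊ j ≟ j₀ ⌋) ⟩
  sumFin (λ j → ⟨ without S j₀ j ⟩ + (if ⌊ j ≟ j₀ ⌋ then ⟨ S j ⟩ else 0))
    ≡⟨ sum-distrib (λ j → ⟨ without S j₀ j ⟩) (λ j → if ⌊ j ≟ j₀ ⌋ then ⟨ S j ⟩ else 0) ⟩
  sumFin (λ j → ⟨ without S j₀ j ⟩) + sumFin (λ j → if ⌊ j ≟ j₀ ⌋ then ⟨ S j ⟩ else 0)
    ≡⟨ cong₂ _+_ (sym (count≡sum (without S j₀))) (trans (sum-point j₀ (λ j → ⟨ S j ⟩)) (one (S j₀) j₀∈S)) ⟩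
  count (without S j₀) + 1
    ≡⟨ +-comm _ 1 ⟩
  suc (count (without S j₀)) ∎
  where
  open ≡-Reasoning
  split : ∀ b d → ⟨ b ⟩ ≡ ⟨ b ∧ not d ⟩ + (if d then ⟨ b ⟩ else 0)
  split false false = refl
  split false true  = refl
  split true  false = refl
  split true  true  = refl
  one : ∀ b → T b → ⟨ b ⟩ ≡ 1
  one true _ = refl

module Orientation {n m : ℕ} (e : Fin m → Edge n) (simple : IsSimple e) where
  open Leaves e

  extend-at-leaf : ∀ S j₀ x → Endpoint x (e j₀) → ¬ ∃ (OtherEdgeAt S j₀ x) →
    EndpointChoice e (without S j₀) → EndpointChoice e S
  extend-at-leaf S j₀ x x∈j₀ alone rest = record
    { choice = choice ; isEndpoint = isEndpoint ; injectiveOnS = injectiveOnS }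
    where
    module R = EndpointChoice rest
    choice : Fin m → Fin n
    choice j = if ⌊ j ≟ j₀ ⌋ then x else R.choice j
    isEndpoint : ∀ j → Endpoint (choice j) (e j)
    isEndpoint j with j ≟ j₀
    ... | yes refl = x∈j₀
    ... | no _     = R.isEndpoint j
    injectiveOnS : ∀ i j → T (S i) → T (S j) → choice i ≡ choice j → i ≡ j
    injectiveOnS i j i∈S j∈S same with i ≟ j₀ | j ≟ j₀
    ... | yes refl | yes refl = refl
    ... | yes refl | no j≢j₀  =
      ⊥-elim (alone (j , j∈S , j≢j₀ , subst (λ z → Endpoint z (e j)) (sym same) (R.isEndpoint j)))
    ... | no i≢j₀  | yes refl =
      ⊥-elim (alone (i , i∈S , i≢j₀ , subst (λ z → Endpoint z (e i)) same (R.isEndpoint i)))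
    ... | no i≢j₀  | no j≢j₀  =
      R.injectiveOnS i j (without-keeps S i i∈S i≢j₀) (without-keeps S j j∈S j≢j₀) same

  endpointChoice : ∀ N (S : Fin m → Bool) → count S ≡ N → IsForest e (λ j → T (S j)) → EndpointChoice e S
  endpointChoice N S size forest with any? (λ j → T? (S j))
  ... | no empty = record
    { choice = λ j → proj₁ (e j) ; isEndpoint = λ j → inj₁ refl
    ; injectiveOnS = λ i _ i∈S _ _ → ⊥-elim (empty (i , i∈S)) }
  endpointChoice zero S size forest | yes nonempty
    with j₀ , j₀∈S , _ ← leaf S simple forest nonempty =
    ⊥-elim (0≢1+n (trans (sym size) (count-without S j₀ j₀∈S)))
  endpointChoice (suc N) S size forest | yes nonempty
    with j₀ , j₀∈S , x , x∈j₀ , alone ← leaf S simple forest nonempty =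
    extend-at-leaf S j₀ x x∈j₀ alone
      (endpointChoice N (without S j₀) (ℕₚ.suc-injective (trans (sym (count-without S j₀ j₀∈S)) size))
        (forest ∘ cycle-mono e (without-⊆ S j₀)))

module ForestWeight {n m : ℕ} (e : Fin m → Edge n) (simple : IsSimple e) where
  open Charging e
  open Orientation e simple

  -- The weights of the edges of a forest F sum to at most 2m: each weight
  -- is at most the degree of the chosen endpoint, and distinct edges of F
  -- choose distinct endpoints.
  forest-weight : (F : Fin m → Bool) → IsForest e (λ j → T (F j)) →
    sumFin (λ j → if F j then minDeg j else 0) ≤ m * 2
  forest-weight F forest = begin
    sumFin (λ j → if F j then minDeg j else 0)
      ≤⟨ sum-mono weight≤degree ⟩
    sumFin (λ j → if F j then deg e m (choice j) else 0)
      ≤⟨ injective-sum F choice injectiveOnS (deg e m) ⟩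
    sumFin (deg e m)
      ≤⟨ handshake e m ⟩
    m * 2 ∎
    where
    open ≤-Reasoning
    open EndpointChoice (endpointChoice _ F refl forest)
    weight≤degree : ∀ j → (if F j then minDeg j else 0) ≤ (if F j then deg e m (choice j) else 0)
    weight≤degree j with F j | isEndpoint j
    ... | false | _ = z≤n
    ... | true  | inj₁ c≡v rewrite c≡v = m⊓n≤m _ _
    ... | true  | inj₂ c≡w rewrite c≡w = m⊓n≤n _ _

  decomposition-weight : ∀ k → DecomposesInto e k → sumFin minDeg ≤ k * (m * 2)
  decomposition-weight k (colour , forests) = begin
    sumFin minDeg
      ≡⟨ sum-cong (λ j → sym (sum-point (colour j) (λ _ → minDeg j))) ⟩
    sumFin (λ j → sumFin (λ c → if ⌊ c ≟ colour j ⌋ then minDeg j else 0))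
      ≡⟨ sum-comm (λ j c → if ⌊ c ≟ colour j ⌋ then minDeg j else 0) ⟩
    sumFin (λ c → sumFin (λ j → if ⌊ c ≟ colour j ⌋ then minDeg j else 0))
      ≤⟨ sum-mono (λ c → forest-weight (λ j → ⌊ c ≟ colour j ⌋)
                           (forests c ∘ cycle-mono e (λ j → sym ∘ toWitness))) ⟩
    sumFin {k} (λ _ → m * 2)
      ≡⟨ sum-const k (m * 2) ⟩
    k * (m * 2) ∎
    where open ≤-Reasoning

twice-weight : ∀ α m → α * (m * 2) + α * (m * 2) ≡ 4 * α * m
twice-weight = solve-∀

lemma2 : (n m : ℕ) (e : Fin m → Edge n) → IsSimple e →
    (α : ℕ) → IsArboricity e α →
    hSum e ≤ 4 * α * m
lemma2 n m e simple α (decomposition , _) = begin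
  hSum e                      ≤⟨ hSum≤minDegs ⟩
  sumFin minDeg + sumFin minDeg ≤⟨ +-mono-≤ weight weight ⟩
  α * (m * 2) + α * (m * 2)   ≡⟨ twice-weight α m ⟩
  4 * α * m                   ∎
  where
  open ≤-Reasoning
  open Charging e
  weight : sumFin minDeg ≤ α * (m * 2)
  weight = ForestWeight.decomposition-weight e simple α decomposition
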